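{- Let $G$ be a finite bipartite graph on $\Sigma_1=\{0,\dots,N-1\}$ with nonempty bipartition classes $V_1,V_2$, $n_i=|V_i|$, and let $G_n$ be as in the context. Let $\underline X,\underline Y$ be independent uniformly chosen vertices of $G_n$ and let $|P(\underline X,\underline Y)|$ denote the length of a shortest path between them in $G_n$. Then $$\frac{4n_1n_2}{N^2}(n-1)<\mathbb E\,|P(\underline X,\underline Y)|<N+\frac{4n_1n_2}{N^2}(n-1).$$
   Context: Edge set $E(G)$; each edge joins $V_1$ to $V_2$. $\mathrm{typ}(x)=i$ if $x\in V_i$; for a word over $\Sigma_1$, its type is $i$ if all letters lie in $V_i$, else $0$. For distinct $\underline x,\underline y\in\Sigma_n=\Sigma_1^n$ let $k$ be the length of their longest common prefix and $\tilde{\underline x},\tilde{\underline y}$ the remaining postfixes. $G_n$ is the graph on $\Sigma_n$ with a loop at every vertex and distinct $\underline x,\underline y$ adjacent iff $\{\mathrm{typ}(\tilde{\underline x}),\mathrm{typ}(\tilde{\underline y})\}=\{1,2\}$ and $\{x_i,y_i\}\in E(G)$ for all $k<i\le n$. -}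

module Defs where

open import Data.Nat using (ℕ; zero; suc; _+_; _*_; _≤_)
open import Data.Bool using (Bool; true; false; if_then_else_; _∧_)
open import Data.Fin using (Fin; _≟_)
open import Data.Vec using (Vec; []; _∷_; lookup)
open import Data.List as L using (List; map; concatMap; length; allFin)
open import Data.Nat.ListAction using (sum)
open import Data.Product using (Σ; _×_; _,_; ∃)
open import Data.Sum using (_⊎_)
open import Relation.Nullary using (¬_; yes; no)
open import Relation.Binary.PropositionalEquality using (_≡_; _≢_)
open import Relation.Binary.Construct.Closure.ReflexiveTransitive using (Star)

data Side : Set where
  one two : Side

sameSide : Side → Side → Bool
sameSide one one = true
sameSide two two = true
sameSide _   _   = false

-- typ: t1 (all letters in V₁), t2 (all letters in V₂), t0 otherwise
data Typ : Set where
  t0 t1 t2 : Typ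

-- A finite bipartite graph G on Σ₁ = Fin N = {0,…,N-1} with bipartition
-- classes V₁ = {x | col x ≡ one}, V₂ = {x | col x ≡ two}, both nonempty;
-- E x y ≡ true  iff  {x,y} ∈ E(G); every edge joins V₁ to V₂.
record BipGraph (N : ℕ) : Set where
  field
    col         : Fin N → Side
    E           : Fin N → Fin N → Bool
    E-sym       : ∀ x y → E x y ≡ true → E y x ≡ true
    E-across    : ∀ x y → E x y ≡ true → col x ≢ col y
    V₁-nonempty : ∃ λ x → col x ≡ one
    V₂-nonempty : ∃ λ x → col x ≡ two

data Walk {A : Set} (R : A → A → Set) : A → A → ℕ → Set where
  here  : ∀ {x} → Walk R x x 0
  there : ∀ {x y z k} → R x y → Walk R y z k → Walk R x z (suc k)

IsShortestDist : {A : Set} (R : A → A → Set) → A → A → ℕ → Set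
IsShortestDist R x y d = Walk R x y d × (∀ k → Walk R x y k → d ≤ k)

-- all words of length n over Fin N, each exactly once (Σ_n)
allWords : (N n : ℕ) → List (Vec (Fin N) n)
allWords N zero    = [] L.∷ L.[]
allWords N (suc n) = concatMap (λ x → map (x ∷_) (allWords N n)) (allFin N)

module _ {N : ℕ} (G : BipGraph N) where
  open BipGraph G

  count : Side → List (Fin N) → ℕ
  count s L.[] = 0
  count s (x L.∷ xs) = if sameSide (col x) s then suc (count s xs) else count s xs

  n₁ n₂ : ℕ
  n₁ = count one (allFin N)
  n₂ = count two (allFin N)

  AdjG : Fin N → Fin N → Set
  AdjG x y = E x y ≡ true

  Connected : Set
  Connected = ∀ x y → Star AdjG x y

  allIn : ∀ {m} → Side → Vec (Fin N) m → Bool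
  allIn s []       = true
  allIn s (x ∷ xs) = sameSide (col x) s ∧ allIn s xs

  -- type of a word (the empty word never occurs as a postfix of distinct words)
  typ : ∀ {m} → Vec (Fin N) m → Typ
  typ []         = t0
  typ w@(_ ∷ _)  = if allIn one w then t1 else (if allIn two w then t2 else t0)

  postfixes : ∀ {n} → Vec (Fin N) n → Vec (Fin N) n → Σ ℕ (λ m → Vec (Fin N) m × Vec (Fin N) m)
  postfixes []       []       = 0 , [] , []
  postfixes (x ∷ xs) (y ∷ ys) with x ≟ y
  ... | yes _ = postfixes xs ys
  ... | no  _ = _ , x ∷ xs , y ∷ ys

  PostfixAdj : Σ ℕ (λ m → Vec (Fin N) m × Vec (Fin N) m) → Set
  PostfixAdj (m , a , b) =
    ((typ a ≡ t1 × typ b ≡ t2) ⊎ (typ a ≡ t2 × typ b ≡ t1))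
    × (∀ (i : Fin m) → E (lookup a i) (lookup b i) ≡ true)

  AdjGn : ∀ {n} → Vec (Fin N) n → Vec (Fin N) n → Set
  AdjGn x y = (x ≡ y) ⊎ (x ≢ y × PostfixAdj (postfixes x y))

  pairSum : (n : ℕ) → (Vec (Fin N) n → Vec (Fin N) n → ℕ) → ℕ
  pairSum n f = sum (map (λ x → sum (map (λ y → f x y) (allWords N n))) (allWords N n))

module Submission where

-- For a word w let alt w be the number of adjacent letter pairs lying in
-- different classes of G, and for x ≠ y let ℓ x y = 1 + alt x̃ + alt ỹ, where
-- x̃, ỹ are the postfixes after the longest common prefix (ℓ x x = 0).  The
-- distance d in Gₙ is squeezed between computable quantities:
--     ℓ x y  ≤  d x y  ≤  alt x + alt y + (N − 1).
-- Lower: one step of Gₙ changes ℓ by at most one (ℓ-step).  Upper: in alt x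
-- steps x becomes a word inside one class (monoize), likewise y, and two such
-- words are joined by moving all letters at once along G-walks of the common
-- length N − 2 or N − 1 (loop erasure, padding and parity; simultaneousWalk).
-- The distance itself is the least walk length, which is decidable.
-- Summing over Σₙ × Σₙ: Σ alt = K (n − 1) Nⁿ⁻² with K = 2 n₁ n₂ ≤ N²/2; the
-- upper estimate then gives the upper bound directly, and a recurrence in n
-- for Σ ℓ shows Σ ℓ > Σ (alt x + alt y), which gives the lower bound.

open import Defs
open import Data.Nat using (ℕ; _+_; _*_; _^_; _∸_; _<_; _≤_)
open import Data.Fin using (Fin)
open import Data.Vec using (Vec)
open import Data.Product using (Σ; _×_)

open import Data.Bool using (true; false; if_then_else_; _∧_)
open import Data.Bool.Properties using (∧-conicalˡ; ∧-conicalʳ)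
import Data.Bool.Properties as Bool
open import Data.Empty using (⊥-elim)
open import Data.Fin using (zero; suc; _≟_)
open import Data.Fin.Properties using (injective⇒≤; all?)
open import Data.List as List using (List; allFin; concatMap)
open import Data.List.Membership.Propositional using (_∈_; _∉_; lose)
open import Data.List.Membership.Propositional.Properties using (∈-lookup; ∈-concat⁺′; ∈-map⁺; ∈-allFin)
open import Data.List.Properties using (map-tabulate; length-tabulate; map-++; map-∘)
import Data.List.Relation.Unary.Any as Any
open import Data.Nat using (zero; suc; z≤n; s≤s; s≤s⁻¹)
open import Data.Nat.Induction using (<-rec)
open import Data.Nat.ListAction using (sum)
open import Data.Nat.ListAction.Properties using (sum-++)
open import Data.Nat.Properties hiding (_≟_)
open import Algebra.Properties.CommutativeSemigroup +-commutativeSemigroup using (interchange)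
open import Data.Nat.Tactic.RingSolver using (solve-∀)
open import Data.Product using (_,_; proj₁; proj₂; ∃)
open import Data.Sum using (_⊎_; inj₁; inj₂)
open import Data.Vec using ([]; _∷_; lookup; map; tabulate; tail)
open import Data.Vec.Properties
  using (∷-injectiveˡ; ∷-injectiveʳ; lookup-map; lookup∘tabulate; tabulate∘lookup; tabulate-cong; ≡-dec)
open import Function using (_∘_; Injective)
open import Relation.Binary.Construct.Closure.ReflexiveTransitive using (Star; ε; _◅_)
open import Relation.Binary.Definitions using (Symmetric)
open import Relation.Binary.PropositionalEquality
open import Relation.Nullary using (Dec; yes; no; does)
open import Relation.Nullary.Decidable using (_×-dec_; _⊎-dec_; ¬?)

module _ {A : Set} {R : A → A → Set} where

  _++ʷ_ : ∀ {x y z k l} → Walk R x y k → Walk R y z l → Walk R x z (k + l)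
  here      ++ʷ w = w
  there r v ++ʷ w = there r (v ++ʷ w)

  _▷_ : ∀ {x y z k} → Walk R x y k → R y z → Walk R x z (suc k)
  here      ▷ s = there s here
  there r w ▷ s = there r (w ▷ s)

  reverseʷ : Symmetric R → ∀ {x y k} → Walk R x y k → Walk R y x k
  reverseʷ sym here        = here
  reverseʷ sym (there r w) = reverseʷ sym w ▷ sym r

  castʷ : ∀ {x y k l} → k ≡ l → Walk R x y k → Walk R x y l
  castʷ refl w = w

  here-inv : ∀ {x y} → Walk R x y 0 → x ≡ y
  here-inv here = refl

  firstStep : ∀ {x y l} → Walk R x y (suc l) → Σ A λ z → R x z × Walk R z y l
  firstStep (there r w) = _ , r , w

  starWalk : ∀ {x y} → Star R x y → ∃ λ k → Walk R x y k
  starWalk ε       = 0 , here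
  starWalk (r ◅ s) = suc (proj₁ (starWalk s)) , there r (proj₂ (starWalk s))

mapʷ : {A B : Set} {R : A → A → Set} {S : B → B → Set} (f : A → B) →
       (∀ {a b} → R a b → S (f a) (f b)) → ∀ {x y k} → Walk R x y k → Walk S (f x) (f y) k
mapʷ f g here        = here
mapʷ f g (there r w) = there (g r) (mapʷ f g w)

Least : (ℕ → Set) → Set
Least P = Σ ℕ λ d → P d × (∀ k → P k → d ≤ k)

leastWitness : {P : ℕ → Set} → (∀ k → Dec (P k)) → ∀ n → P n → Least P
leastWitness {P} P? = <-rec (λ n → P n → Least P) search
  where
  search : ∀ n → (∀ {m} → m < n → P m → Least P) → P n → Least P
  search n below pn with anyUpTo? P? n
  ... | yes (m , m<n , pm) = below m<n pm
  ... | no none            = n , pn , λ k pk → ≮⇒≥ (λ k<n → none (k , k<n , pk))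

-- Loop erasure: in a graph on Fin N every walk can be shortened to one
-- visiting each vertex at most once, hence to one with fewer than N steps.
module LoopErasure {N : ℕ} {R : Fin N → Fin N → Set} where

  open import Data.List.Membership.DecPropositional (_≟_ {N}) using (_∈?_)

  data Distinct : List (Fin N) → Set where
    []  : Distinct List.[]
    _∷_ : ∀ {x xs} → x ∉ xs → Distinct xs → Distinct (x List.∷ xs)

  vertices : ∀ {x y k} → Walk R x y k → List (Fin N)
  vertices (here {x})      = x List.∷ List.[]
  vertices (there {x} r w) = x List.∷ vertices w

  length-vertices : ∀ {x y k} (w : Walk R x y k) → List.length (vertices w) ≡ suc k
  length-vertices here        = refl
  length-vertices (there r w) = cong suc (length-vertices w)

  SimpleWalk : Fin N → Fin N → ℕ → Set
  SimpleWalk x y k = Σ ℕ λ l → l ≤ k × Σ (Walk R x y l) (Distinct ∘ vertices)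

  suffixFrom : ∀ {a x y k} (w : Walk R x y k) → Distinct (vertices w) → a ∈ vertices w → SimpleWalk a y k
  suffixFrom here        d       (Any.here refl) = 0 , z≤n , here , d
  suffixFrom (there r w) d       (Any.here refl) = _ , ≤-refl , there r w , d
  suffixFrom (there r w) (_ ∷ d) (Any.there a∈) with suffixFrom w d a∈
  ... | l , l≤k , w′ , d′ = l , m≤n⇒m≤1+n l≤k , w′ , d′

  -- Erase the closed sub-walk at each vertex that is visited again later.
  erase : ∀ {x y k} → Walk R x y k → SimpleWalk x y k
  erase here = 0 , z≤n , here , (λ ()) ∷ []
  erase {x} (there r w) with erase w
  ... | l , l≤k , w′ , d′ with x ∈? vertices w′
  ...   | yes x∈ = let (l″ , l″≤l , w″ , d″) = suffixFrom w′ d′ x∈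
                   in l″ , m≤n⇒m≤1+n (≤-trans l″≤l l≤k) , w″ , d″
  ...   | no  x∉ = suc l , s≤s l≤k , there r w′ , x∉ ∷ d′

  lookup-injective : ∀ {xs} → Distinct xs → Injective _≡_ _≡_ (List.lookup xs)
  lookup-injective (x∉ ∷ d) {zero}  {zero}  eq = refl
  lookup-injective (x∉ ∷ d) {zero}  {suc j} eq = ⊥-elim (x∉ (subst (_∈ _) (sym eq) (∈-lookup j)))
  lookup-injective (x∉ ∷ d) {suc i} {zero}  eq = ⊥-elim (x∉ (subst (_∈ _) eq (∈-lookup i)))
  lookup-injective (x∉ ∷ d) {suc i} {suc j} eq = cong suc (lookup-injective d eq)

  -- A repetition-free walk visits at most N vertices, so it has fewer than N steps.
  shortWalk : ∀ {x y k} → Walk R x y k → ∃ λ l → suc l ≤ N × Walk R x y l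
  shortWalk w with erase w
  ... | l , _ , w′ , d = l , subst (_≤ N) (length-vertices w′) (injective⇒≤ (lookup-injective d)) , w′

flip : Side → Side
flip one = two
flip two = one

flips : ℕ → Side → Side
flips zero    s = s
flips (suc k) s = flip (flips k s)

flips-flip : ∀ k s → flips k (flip s) ≡ flip (flips k s)
flips-flip zero    s = refl
flips-flip (suc k) s = cong flip (flips-flip k s)

flip-≢ : ∀ s → flip s ≢ s
flip-≢ one ()
flip-≢ two ()

flip-involutive : ∀ s → flip (flip s) ≡ s
flip-involutive one = refl
flip-involutive two = refl

≢⇒flip : ∀ {s t} → s ≢ t → t ≡ flip s
≢⇒flip {one} {one} s≢t = ⊥-elim (s≢t refl)
≢⇒flip {one} {two} _   = refl
≢⇒flip {two} {one} _   = refl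
≢⇒flip {two} {two} s≢t = ⊥-elim (s≢t refl)

sameSide-refl : ∀ s → sameSide s s ≡ true
sameSide-refl one = refl
sameSide-refl two = refl

sameSide⇒≡ : ∀ s t → sameSide s t ≡ true → s ≡ t
sameSide⇒≡ one one _ = refl
sameSide⇒≡ two two _ = refl

change : Side → Side → ℕ
change s t = if sameSide s t then 0 else 1

change-self : ∀ s → change s s ≡ 0
change-self one = refl
change-self two = refl

change≤1 : ∀ s t → change s t ≤ 1
change≤1 one one = z≤n
change≤1 one two = ≤-refl
change≤1 two one = ≤-refl
change≤1 two two = z≤n

change-cases : ∀ s t → (t ≡ s × change s t ≡ 0) ⊎ (t ≡ flip s × change s t ≡ 1)
change-cases one one = inj₁ (refl , refl)
change-cases one two = inj₂ (refl , refl)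
change-cases two one = inj₂ (refl , refl)
change-cases two two = inj₁ (refl , refl)

sideTyp : Side → Typ
sideTyp one = t1
sideTyp two = t2

_≟ᵗ_ : (s t : Typ) → Dec (s ≡ t)
t0 ≟ᵗ t0 = yes refl
t1 ≟ᵗ t1 = yes refl
t2 ≟ᵗ t2 = yes refl
t0 ≟ᵗ t1 = no λ ()
t0 ≟ᵗ t2 = no λ ()
t1 ≟ᵗ t0 = no λ ()
t1 ≟ᵗ t2 = no λ ()
t2 ≟ᵗ t0 = no λ ()
t2 ≟ᵗ t1 = no λ ()

vec-ext : ∀ {A : Set} {m} (u v : Vec A m) → (∀ i → lookup u i ≡ lookup v i) → u ≡ v
vec-ext u v eq = trans (sym (tabulate∘lookup u)) (trans (tabulate-cong eq) (tabulate∘lookup v))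

allWords-complete : ∀ {N m} (v : Vec (Fin N) m) → v ∈ allWords N m
allWords-complete [] = Any.here refl
allWords-complete {N} {suc m} (a ∷ v) =
  ∈-concat⁺′ (∈-map⁺ (a ∷_) (allWords-complete v))
             (∈-map⁺ (λ x → List.map (x ∷_) (allWords N m)) (∈-allFin a))

-- Facts about G and Gₙ that do not need connectivity.
module Words {N : ℕ} (G : BipGraph N) where
  open BipGraph G

  Word : ℕ → Set
  Word = Vec (Fin N)

  Edge : Fin N → Fin N → Set
  Edge = AdjG G

  Step : ∀ {m} → Word m → Word m → Set
  Step = AdjGn G

  edge-flips : ∀ {a b} → Edge a b → col b ≡ flip (col a)
  edge-flips {a} {b} e = ≢⇒flip (E-across a b e)

  walk-parity : ∀ {a b k} → Walk Edge a b k → col b ≡ flips k (col a)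
  walk-parity here = refl
  walk-parity {a} (there {k = k} e w) =
    trans (walk-parity w) (trans (cong (flips k) (edge-flips e)) (flips-flip k (col a)))

  Mono : ∀ {m} → Side → Word m → Set
  Mono s u = ∀ i → col (lookup u i) ≡ s

  mono-cons : ∀ {m s a} {w : Word m} → col a ≡ s → Mono s w → Mono s (a ∷ w)
  mono-cons ca p zero    = ca
  mono-cons ca p (suc i) = p i

  allIn⇒mono : ∀ {m} s (u : Word m) → allIn G s u ≡ true → Mono s u
  allIn⇒mono s (a ∷ u) p zero    = sameSide⇒≡ (col a) s (∧-conicalˡ _ _ p)
  allIn⇒mono s (a ∷ u) p (suc i) = allIn⇒mono s u (∧-conicalʳ _ _ p) i

  mono⇒allIn : ∀ {m} s (u : Word m) → Mono s u → allIn G s u ≡ true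
  mono⇒allIn s []      p = refl
  mono⇒allIn s (a ∷ u) p =
    cong₂ _∧_ (trans (cong (λ t → sameSide t s) (p zero)) (sameSide-refl s)) (mono⇒allIn s u (p ∘ suc))

  typ-mono : ∀ {m} s (u : Word (suc m)) → Mono s u → typ G u ≡ sideTyp s
  typ-mono one (a ∷ u) p rewrite mono⇒allIn one (a ∷ u) p = refl
  typ-mono two (a ∷ u) p with mono⇒allIn two (a ∷ u) p
  ... | inV₂ rewrite p zero | inV₂ = refl

  typ⇒mono : ∀ {m} s (u : Word m) → typ G u ≡ sideTyp s → Mono s u
  typ⇒mono s (a ∷ u) eq with allIn G one (a ∷ u) in inV₁ | allIn G two (a ∷ u) in inV₂ | s | eq
  ... | true  | _     | one | _  = allIn⇒mono one (a ∷ u) inV₁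
  ... | false | true  | two | _  = allIn⇒mono two (a ∷ u) inV₂
  ... | true  | _     | two | ()
  ... | false | true  | one | ()
  ... | false | false | one | ()
  ... | false | false | two | ()

  OppositeTypes : ∀ {m} → Word m → Word m → Set
  OppositeTypes u u′ = (typ G u ≡ t1 × typ G u′ ≡ t2) ⊎ (typ G u ≡ t2 × typ G u′ ≡ t1)

  mono⇒opposite : ∀ {m} s (u u′ : Word (suc m)) → Mono s u → Mono (flip s) u′ → OppositeTypes u u′
  mono⇒opposite one u u′ p p′ = inj₁ (typ-mono one u p , typ-mono two u′ p′)
  mono⇒opposite two u u′ p p′ = inj₂ (typ-mono two u p , typ-mono one u′ p′)

  opposite-sym : ∀ {m} (u u′ : Word m) → OppositeTypes u u′ → OppositeTypes u′ u
  opposite-sym u u′ (inj₁ (p , q)) = inj₂ (q , p)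
  opposite-sym u u′ (inj₂ (p , q)) = inj₁ (q , p)

  alt : ∀ {m} → Word m → ℕ
  alt []          = 0
  alt (a ∷ [])    = 0
  alt (a ∷ b ∷ w) = change (col a) (col b) + alt (b ∷ w)

  alt-mono : ∀ {m s} (u : Word m) → Mono s u → alt u ≡ 0
  alt-mono []          p = refl
  alt-mono (a ∷ [])    p = refl
  alt-mono (a ∷ b ∷ w) p =
    cong₂ _+_ (trans (cong (λ t → change t (col b)) (trans (p zero) (sym (p (suc zero))))) (change-self (col b)))
              (alt-mono (b ∷ w) (p ∘ suc))

  alt-opposite : ∀ {m} (u u′ : Word m) → OppositeTypes u u′ → alt u ≡ 0 × alt u′ ≡ 0
  alt-opposite u u′ (inj₁ (p , q)) = alt-mono u (typ⇒mono one u p) , alt-mono u′ (typ⇒mono two u′ q)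
  alt-opposite u u′ (inj₂ (p , q)) = alt-mono u (typ⇒mono two u p) , alt-mono u′ (typ⇒mono one u′ q)

  alt-tail : ∀ {m} a (w : Word m) → alt w ≤ alt (a ∷ w)
  alt-tail a []      = z≤n
  alt-tail a (b ∷ w) = m≤n+m _ _

  step-cons : ∀ {m a} {u u′ : Word m} → Step u u′ → Step (a ∷ u) (a ∷ u′)
  step-cons (inj₁ refl) = inj₁ refl
  step-cons {a = a} (inj₂ (u≢u′ , adj)) with a ≟ a
  ... | yes _  = inj₂ (u≢u′ ∘ ∷-injectiveʳ , adj)
  ... | no a≢a = ⊥-elim (a≢a refl)

  postfixAdj-sym : ∀ {m} (x y : Word m) → PostfixAdj G (postfixes G x y) → PostfixAdj G (postfixes G y x)
  postfixAdj-sym []      []      p = p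
  postfixAdj-sym (a ∷ x) (b ∷ y) p with a ≟ b | b ≟ a
  ... | yes _   | yes _   = postfixAdj-sym x y p
  ... | yes a≡b | no  b≢a = ⊥-elim (b≢a (sym a≡b))
  ... | no  a≢b | yes b≡a = ⊥-elim (a≢b (sym b≡a))
  ... | no  _   | no  _   = opposite-sym (a ∷ x) (b ∷ y) (proj₁ p) , λ i → E-sym _ _ (proj₂ p i)

  step-sym : ∀ {m} {x y : Word m} → Step x y → Step y x
  step-sym (inj₁ refl)                = inj₁ refl
  step-sym {x = x} {y} (inj₂ (x≢y , p)) = inj₂ (x≢y ∘ sym , postfixAdj-sym x y p)

  -- Moving every letter of a one-class word across an edge of G at once is a
  -- single step of Gₙ: the words differ in their first letter, so the whole
  -- words are the postfixes.
  monoStep : ∀ {m s} (u u′ : Word (suc m)) → Mono s u → Mono (flip s) u′ →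
             (∀ i → Edge (lookup u i) (lookup u′ i)) → Step u u′
  monoStep {s = s} (a ∷ w) (a′ ∷ w′) p p′ es with a ≟ a′
  ... | yes refl = ⊥-elim (flip-≢ s (trans (sym (p′ zero)) (p zero)))
  ... | no a≢a′  = inj₂ (a≢a′ ∘ ∷-injectiveˡ , mono⇒opposite s _ _ p p′ , es)

  simultaneousWalk : ∀ {m} l s (u v : Word (suc m)) → Mono s u →
                     (∀ i → Walk Edge (lookup u i) (lookup v i) l) → Walk Step u v l
  simultaneousWalk zero s u v p ws = subst (λ t → Walk Step u t 0) (vec-ext u v (here-inv ∘ ws)) here
  simultaneousWalk {m} (suc l) s u v p ws =
    there (monoStep u u′ p p′ edges) (simultaneousWalk l (flip s) u′ v p′ rest)
    where
    next : ∀ i → Σ (Fin N) λ c → Edge (lookup u i) c × Walk Edge c (lookup v i) l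
    next i = firstStep (ws i)
    u′ : Word (suc m)
    u′ = tabulate (proj₁ ∘ next)
    at : ∀ i → lookup u′ i ≡ proj₁ (next i)
    at = lookup∘tabulate (proj₁ ∘ next)
    p′ : Mono (flip s) u′
    p′ i = trans (cong col (at i)) (trans (edge-flips (proj₁ (proj₂ (next i)))) (cong flip (p i)))
    edges : ∀ i → Edge (lookup u i) (lookup u′ i)
    edges i = subst (Edge (lookup u i)) (sym (at i)) (proj₁ (proj₂ (next i)))
    rest : ∀ i → Walk Edge (lookup u′ i) (lookup v i) l
    rest i = subst (λ c → Walk Edge c (lookup v i) l) (sym (at i)) (proj₂ (proj₂ (next i)))

  -- It changes by at most one
  -- along a step of Gₙ (ℓ-step) and therefore never exceeds the distance.
  ℓ : ∀ {m} → Word m → Word m → ℕ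
  ℓ []      []      = 0
  ℓ (a ∷ x) (b ∷ y) with a ≟ b
  ... | yes _ = ℓ x y
  ... | no  _ = suc (alt (a ∷ x) + alt (b ∷ y))

  ℓ-self : ∀ {m} (x : Word m) → ℓ x x ≡ 0
  ℓ-self []      = refl
  ℓ-self (a ∷ x) with a ≟ a
  ... | yes _  = ℓ-self x
  ... | no a≢a = ⊥-elim (a≢a refl)

  -- Removing a common prefix does not increase alt.
  ℓ≤alt : ∀ {m} (x y : Word m) → ℓ x y ≤ suc (alt x + alt y)
  ℓ≤alt []      []      = z≤n
  ℓ≤alt (a ∷ x) (b ∷ y) with a ≟ b
  ... | yes refl = ≤-trans (ℓ≤alt x y) (s≤s (+-mono-≤ (alt-tail a x) (alt-tail a y)))
  ... | no  _    = ≤-refl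

  alt-ℓ : ∀ {m} b (w y : Word m) → alt (b ∷ y) ≤ alt (b ∷ w) + ℓ w y
  alt-ℓ b []       []      = z≤n
  alt-ℓ b (c′ ∷ w) (c ∷ y) with c′ ≟ c
  ... | yes refl = ≤-trans (+-monoʳ-≤ (change (col b) (col c′)) (alt-ℓ c′ w y))
                           (≤-reflexive (sym (+-assoc (change (col b) (col c′)) _ _)))
  ... | no  _    = ≤-trans (+-monoˡ-≤ (alt (c ∷ y)) (change≤1 (col b) (col c)))
                     (≤-trans (s≤s (m≤n+m (alt (c ∷ y)) (alt (c′ ∷ w))))
                       (m≤n+m (suc (alt (c′ ∷ w) + alt (c ∷ y))) (alt (b ∷ c′ ∷ w))))

  alt-step : ∀ {m} c (u u′ : Word m) → Step u u′ → alt (c ∷ u) ≤ suc (alt (c ∷ u′))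
  alt-step c u .u (inj₁ refl) = n≤1+n _
  alt-step c [] [] (inj₂ ([]≢[] , _)) = ⊥-elim ([]≢[] refl)
  alt-step c (d ∷ u) (d′ ∷ u′) (inj₂ (u≢u′ , adj)) with d ≟ d′
  ... | yes refl = ≤-trans (+-monoʳ-≤ (change (col c) (col d))
                             (alt-step d u u′ (inj₂ (u≢u′ ∘ cong (d ∷_) , adj))))
                           (≤-reflexive (+-suc _ _))
  ... | no  _    = ≤-trans (≤-reflexive (trans (cong (change (col c) (col d) +_) alt-du≡0) (+-identityʳ _)))
                           (≤-trans (change≤1 (col c) (col d)) (s≤s z≤n))
    where
    alt-du≡0 : alt (d ∷ u) ≡ 0
    alt-du≡0 = proj₁ (alt-opposite (d ∷ u) (d′ ∷ u′) (proj₁ adj))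

  ℓ-step : ∀ {m} (w w′ y : Word m) → Step w w′ → ℓ w y ≤ suc (ℓ w′ y)
  ℓ-step w .w y (inj₁ refl) = n≤1+n _
  ℓ-step [] [] [] (inj₂ ([]≢[] , _)) = ⊥-elim ([]≢[] refl)
  ℓ-step (a ∷ w) (a′ ∷ w′) (b ∷ y) (inj₂ (w≢w′ , adj)) with a ≟ a′
  ℓ-step (a ∷ w) (a ∷ w′) (b ∷ y) (inj₂ (w≢w′ , adj)) | yes refl with a ≟ b
  ... | yes refl = ℓ-step w w′ y (inj₂ (w≢w′ ∘ cong (a ∷_) , adj))
  ... | no  _    = s≤s (+-monoˡ-≤ (alt (b ∷ y)) (alt-step a w w′ (inj₂ (w≢w′ ∘ cong (a ∷_) , adj))))
  ℓ-step (a ∷ w) (a′ ∷ w′) (b ∷ y) (inj₂ (w≢w′ , adj)) | no a≢a′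
    with alt-opposite (a ∷ w) (a′ ∷ w′) (proj₁ adj) | a ≟ b | a′ ≟ b
  ... | _ , _   | yes refl | yes refl = ⊥-elim (a≢a′ refl)
  ... | z , _   | yes refl | no  _    =
        ≤-trans (ℓ≤alt w y)
          (s≤s (≤-trans (+-mono-≤ (≤-trans (alt-tail a w) (≤-reflexive z)) (alt-tail a y))
                 (≤-trans (m≤n+m (alt (a ∷ y)) (alt (a′ ∷ w′))) (n≤1+n _))))
  ... | z , z′  | no  _    | yes refl =
        s≤s (≤-trans (≤-reflexive (cong (_+ alt (a′ ∷ y)) z))
              (≤-trans (alt-ℓ a′ w′ y) (≤-reflexive (cong (_+ ℓ w′ y) z′))))
  ... | z , _   | no  _    | no  _    =
        s≤s (≤-trans (≤-reflexive (cong (_+ alt (b ∷ y)) z))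
              (≤-trans (m≤n+m (alt (b ∷ y)) (alt (a′ ∷ w′))) (n≤1+n _)))

  walk-ℓ : ∀ {m} {x y : Word m} {k} → Walk Step x y k → ℓ x y ≤ k
  walk-ℓ {y = y} here                     = ≤-reflexive (ℓ-self y)
  walk-ℓ {x = x} {y} (there {y = z} s w) = ≤-trans (ℓ-step x z y s) (s≤s (walk-ℓ w))

  postfixAdj? : ∀ p → Dec (PostfixAdj G p)
  postfixAdj? (m , u , u′) =
    (((typ G u ≟ᵗ t1) ×-dec (typ G u′ ≟ᵗ t2)) ⊎-dec ((typ G u ≟ᵗ t2) ×-dec (typ G u′ ≟ᵗ t1)))
    ×-dec all? (λ i → E (lookup u i) (lookup u′ i) Bool.≟ true)

  _≟ʷ_ : ∀ {m} (x y : Word m) → Dec (x ≡ y)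
  _≟ʷ_ = ≡-dec _≟_

  step? : ∀ {m} (x y : Word m) → Dec (Step x y)
  step? x y = (x ≟ʷ y) ⊎-dec (¬? (x ≟ʷ y) ×-dec postfixAdj? (postfixes G x y))

  walk? : ∀ {m} k (x y : Word m) → Dec (Walk Step x y k)
  walk? zero x y with x ≟ʷ y
  ... | yes refl = yes here
  ... | no  x≢y  = no λ { here → x≢y refl }
  walk? {m} (suc k) x y with Any.any? (λ z → step? x z ×-dec walk? k z y) (allWords N m)
  ... | yes found = let (z , s , w) = Any.satisfied found in yes (there s w)
  ... | no  none  = no λ { (there {y = z} s w) → none (lose (allWords-complete z) (s , w)) }

module Distance (M : ℕ) (G : BipGraph (suc (suc M))) (conn : Connected G) where
  open BipGraph G
  open Words G

  oppositeVertex : ∀ s → ∃ λ x → col x ≡ flip s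
  oppositeVertex one = V₂-nonempty
  oppositeVertex two = V₁-nonempty

  neighbour : ∀ a → ∃ λ c → Edge a c
  neighbour a with oppositeVertex (col a)
  ... | x , cx with conn a x
  ...   | ε     = ⊥-elim (flip-≢ (col a) (sym cx))
  ...   | e ◅ _ = _ , e

  pad : ∀ {a b k} → Walk Edge a b k → Walk Edge a b (suc (suc k))
  pad {a} w = there (proj₂ (neighbour a)) (there (E-sym _ _ (proj₂ (neighbour a))) w)

  -- The lengths N − 2 and N − 1, one of each parity.
  Near : ℕ → Set
  Near l = l ≡ M ⊎ l ≡ suc M

  padToNear : ∀ gap {a b k} → k + gap ≡ suc M → Walk Edge a b k → ∃ λ l → Near l × Walk Edge a b l
  padToNear zero            {k = k} eq w = k , inj₂ (trans (sym (+-identityʳ k)) eq) , w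
  padToNear (suc zero)      {k = k} eq w = k , inj₁ (suc-injective (trans (+-comm 1 k) eq)) , w
  padToNear (suc (suc gap)) {k = k} eq w =
    padToNear gap (trans (sym (trans (+-suc k (suc gap)) (cong suc (+-suc k gap)))) eq) (pad w)

  -- Any two vertices are joined by a walk of length N − 2 or N − 1:
  -- shorten a connecting walk below N steps, then pad it.
  nearWalk : ∀ a b → ∃ λ l → Near l × Walk Edge a b l
  nearWalk a b with LoopErasure.shortWalk (proj₂ (starWalk (conn a b)))
  ... | k , k<N , w = padToNear _ (m+[n∸m]≡n (s≤s⁻¹ k<N)) w

  -- By parity, the endpoints' sides determine which of the two lengths occurs.
  near-unique : ∀ {l l′ s} → Near l → Near l′ → flips l s ≡ flips l′ s → l ≡ l′
  near-unique (inj₁ refl) (inj₁ refl) _  = refl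
  near-unique (inj₂ refl) (inj₂ refl) _  = refl
  near-unique (inj₁ refl) (inj₂ refl) eq = ⊥-elim (flip-≢ _ (sym eq))
  near-unique (inj₂ refl) (inj₁ refl) eq = ⊥-elim (flip-≢ _ eq)

  near≤ : ∀ {l} → Near l → l ≤ suc M
  near≤ (inj₁ refl) = n≤1+n M
  near≤ (inj₂ refl) = ≤-refl

  neighbourStep : ∀ {m s} (u : Word (suc m)) → Mono s u →
                  Mono (flip s) (map (proj₁ ∘ neighbour) u) × Step u (map (proj₁ ∘ neighbour) u)
  neighbourStep {s = s} u p = p′ , monoStep u u′ p p′ edges
    where
    u′ = map (proj₁ ∘ neighbour) u
    p′ : Mono (flip s) u′
    p′ i = trans (cong col (lookup-map i _ u))
                 (trans (edge-flips (proj₂ (neighbour (lookup u i)))) (cong flip (p i)))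
    edges : ∀ i → Edge (lookup u i) (lookup u′ i)
    edges i = subst (Edge (lookup u i)) (sym (lookup-map i _ u)) (proj₂ (neighbour (lookup u i)))

  -- A word a ∷ w reaches a word a ∷ z inside the class of a in alt (a ∷ w)
  -- steps: each side change is removed by moving the whole block after it.
  monoize : ∀ {m} a (w : Word m) → ∃ λ z → Mono (col a) (a ∷ z) × Walk Step (a ∷ w) (a ∷ z) (alt (a ∷ w))
  monoize a [] = [] , mono-cons refl (λ ()) , here
  monoize a (d ∷ w) with monoize d w | change-cases (col a) (col d)
  ... | z , p , walk | inj₁ (same , zero-change) =
        d ∷ z , mono-cons refl (subst (λ s → Mono s (d ∷ z)) same p) ,
        castʷ (cong (_+ alt (d ∷ w)) (sym zero-change)) (mapʷ (a ∷_) step-cons walk)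
  ... | z , p , walk | inj₂ (flipped , one-change) =
        u′ , mono-cons refl (subst (λ s → Mono s u′) back (proj₁ moved)) ,
        castʷ (cong (_+ alt (d ∷ w)) (sym one-change))
              (mapʷ (a ∷_) step-cons walk ▷ step-cons (proj₂ moved))
    where
    u′ = map (proj₁ ∘ neighbour) (d ∷ z)
    moved = neighbourStep (d ∷ z) p
    back : flip (col d) ≡ col a
    back = trans (cong flip flipped) (flip-involutive (col a))

  -- Upper bound: make x and y one-class words, then move all letters along
  -- G-walks of the same length N − 2 or N − 1 simultaneously.
  upperWalk : ∀ {m} (x y : Word (suc m)) → ∃ λ k → k ≤ alt x + alt y + suc M × Walk Step x y k
  upperWalk (a ∷ x) (b ∷ y) with monoize a x | monoize b y | nearWalk a b
  ... | zx , px , wx | zy , py , wy | l , near , wab =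
    alt (a ∷ x) + (l + alt (b ∷ y)) , bound ,
    (wx ++ʷ (simultaneousWalk l (col a) (a ∷ zx) (b ∷ zy) px letterWalk ++ʷ reverseʷ step-sym wy))
    where
    letterWalk : ∀ i → Walk Edge (lookup (a ∷ zx) i) (lookup (b ∷ zy) i) l
    letterWalk i with nearWalk (lookup (a ∷ zx) i) (lookup (b ∷ zy) i)
    ... | lᵢ , nearᵢ , wᵢ = castʷ (near-unique nearᵢ near parity) wᵢ
      where
      parity : flips lᵢ (col a) ≡ flips l (col a)
      parity = trans (cong (flips lᵢ) (sym (px i)))
                 (trans (sym (walk-parity wᵢ)) (trans (py i) (walk-parity wab)))
    bound : alt (a ∷ x) + (l + alt (b ∷ y)) ≤ alt (a ∷ x) + alt (b ∷ y) + suc M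
    bound = begin
      alt (a ∷ x) + (l + alt (b ∷ y))      ≡⟨ cong (alt (a ∷ x) +_) (+-comm l _) ⟩
      alt (a ∷ x) + (alt (b ∷ y) + l)      ≤⟨ +-monoʳ-≤ (alt (a ∷ x)) (+-monoʳ-≤ (alt (b ∷ y)) (near≤ near)) ⟩
      alt (a ∷ x) + (alt (b ∷ y) + suc M)  ≡⟨ +-assoc (alt (a ∷ x)) _ _ ⟨
      alt (a ∷ x) + alt (b ∷ y) + suc M    ∎
      where open ≤-Reasoning

  shortest : ∀ {m} (x y : Word (suc m)) → Least (λ k → Walk Step x y k)
  shortest x y = leastWitness (λ k → walk? k x y) _ (proj₂ (proj₂ (upperWalk x y)))

  dist : ∀ {m} → Word (suc m) → Word (suc m) → ℕ
  dist x y = proj₁ (shortest x y)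

  dist-isShortest : ∀ {m} (x y : Word (suc m)) → IsShortestDist Step x y (dist x y)
  dist-isShortest x y = proj₂ (shortest x y)

  dist-upper : ∀ {m} (x y : Word (suc m)) → dist x y ≤ alt x + alt y + suc M
  dist-upper x y = let (k , k≤ , w) = upperWalk x y in ≤-trans (proj₂ (dist-isShortest x y) k w) k≤

  dist-lower : ∀ {m} (x y : Word (suc m)) → ℓ x y ≤ dist x y
  dist-lower x y = walk-ℓ (proj₁ (dist-isShortest x y))

sumOver : {A : Set} → (A → ℕ) → List A → ℕ
sumOver f xs = sum (List.map f xs)

syntax sumOver (λ x → e) xs = ∑[ x ∈ xs ] e

module _ {A : Set} where

  sum-cong : ∀ {f g : A → ℕ} → (∀ x → f x ≡ g x) → ∀ xs → sumOver f xs ≡ sumOver g xs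
  sum-cong f≡g List.[]         = refl
  sum-cong f≡g (x List.∷ xs) = cong₂ _+_ (f≡g x) (sum-cong f≡g xs)

  sum-mono : ∀ {f g : A → ℕ} → (∀ x → f x ≤ g x) → ∀ xs → sumOver f xs ≤ sumOver g xs
  sum-mono f≤g List.[]         = z≤n
  sum-mono f≤g (x List.∷ xs) = +-mono-≤ (f≤g x) (sum-mono f≤g xs)

  sum-+ : ∀ (f g : A → ℕ) xs → ∑[ x ∈ xs ] (f x + g x) ≡ sumOver f xs + sumOver g xs
  sum-+ f g List.[]         = refl
  sum-+ f g (x List.∷ xs) =
    trans (cong (f x + g x +_) (sum-+ f g xs)) (interchange (f x) (g x) (sumOver f xs) (sumOver g xs))

  sum-*ˡ : ∀ c (f : A → ℕ) xs → ∑[ x ∈ xs ] (c * f x) ≡ c * sumOver f xs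
  sum-*ˡ c f List.[]         = sym (*-zeroʳ c)
  sum-*ˡ c f (x List.∷ xs) = trans (cong (c * f x +_) (sum-*ˡ c f xs)) (sym (*-distribˡ-+ c (f x) _))

  sum-const : ∀ c (xs : List A) → ∑[ x ∈ xs ] c ≡ List.length xs * c
  sum-const c List.[]         = refl
  sum-const c (x List.∷ xs) = cong (c +_) (sum-const c xs)

module _ {A B : Set} where

  sum-map : ∀ (f : B → ℕ) (h : A → B) xs → sumOver f (List.map h xs) ≡ sumOver (f ∘ h) xs
  sum-map f h xs = cong sum (sym (map-∘ xs))

  sum-concatMap : ∀ (f : B → ℕ) (g : A → List B) xs →
                  sumOver f (concatMap g xs) ≡ ∑[ x ∈ xs ] sumOver f (g x)
  sum-concatMap f g List.[]         = refl
  sum-concatMap f g (x List.∷ xs) =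
    trans (cong sum (map-++ f (g x) (concatMap g xs)))
      (trans (sum-++ (List.map f (g x)) _) (cong (sumOver f (g x) +_) (sum-concatMap f g xs)))

onDiagonal : ∀ {n} → Fin n → Fin n → ℕ → ℕ
onDiagonal a b v = if does (a ≟ b) then v else 0

sum-allFin-suc : ∀ {n} (f : Fin (suc n) → ℕ) → sumOver f (allFin (suc n)) ≡ f zero + sumOver (f ∘ suc) (allFin n)
sum-allFin-suc {n} f = cong (f zero +_) (trans (cong (sumOver f) (sym (map-tabulate (λ i → i) suc))) (sum-map f suc (allFin n)))

sum-onDiagonal : ∀ {n} (a : Fin n) (h : Fin n → ℕ) → ∑[ b ∈ allFin n ] onDiagonal a b (h b) ≡ h a
sum-onDiagonal {suc n} zero h =
  trans (sum-allFin-suc (λ b → onDiagonal zero b (h b))) (trans (cong (h zero +_) (trans (sum-const 0 (allFin n)) (*-zeroʳ (List.length (allFin n))))) (+-identityʳ _))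
sum-onDiagonal {suc n} (suc a) h =
  trans (sum-allFin-suc (λ b → onDiagonal (suc a) b (h b))) (sum-onDiagonal a (h ∘ suc))

onDiagonal-sum : ∀ {n} {A : Set} (a b : Fin n) (F : A → ℕ) xs →
                 ∑[ y ∈ xs ] onDiagonal a b (F y) ≡ onDiagonal a b (sumOver F xs)
onDiagonal-sum a b F xs with does (a ≟ b)
... | true  = refl
... | false = trans (sum-const 0 xs) (*-zeroʳ (List.length xs))

module WordSums (N : ℕ) where

  W : (m : ℕ) → List (Vec (Fin N) m)
  W m = allWords N m

  sum-words-suc : ∀ m (f : Vec (Fin N) (suc m) → ℕ) →
                  sumOver f (W (suc m)) ≡ ∑[ a ∈ allFin N ] ∑[ w ∈ W m ] f (a ∷ w)
  sum-words-suc m f = trans (sum-concatMap f (λ a → List.map (a ∷_) (W m)) (allFin N))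
                            (sum-cong (λ a → sum-map f (a ∷_) (W m)) (allFin N))

  sum-const-letters : ∀ c → ∑[ a ∈ allFin N ] c ≡ N * c
  sum-const-letters c = trans (sum-const c (allFin N)) (cong (_* c) (length-tabulate {n = N} (λ i → i)))

  sum-const-words : ∀ m c → ∑[ w ∈ W m ] c ≡ N ^ m * c
  sum-const-words zero    c = refl
  sum-const-words (suc m) c = begin
    ∑[ w ∈ W (suc m) ] c               ≡⟨ sum-words-suc m (λ _ → c) ⟩
    ∑[ a ∈ allFin N ] ∑[ w ∈ W m ] c   ≡⟨ sum-cong (λ _ → sum-const-words m c) (allFin N) ⟩
    ∑[ a ∈ allFin N ] (N ^ m * c)      ≡⟨ sum-const-letters (N ^ m * c) ⟩
    N * (N ^ m * c)                    ≡⟨ *-assoc N (N ^ m) c ⟨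
    N ^ suc m * c                      ∎
    where open ≡-Reasoning

  pairSumW : ∀ m → (Vec (Fin N) m → Vec (Fin N) m → ℕ) → ℕ
  pairSumW m f = ∑[ x ∈ W m ] ∑[ y ∈ W m ] f x y

  pairSum-cong : ∀ m {f g} → (∀ x y → f x y ≡ g x y) → pairSumW m f ≡ pairSumW m g
  pairSum-cong m f≡g = sum-cong (λ x → sum-cong (f≡g x) (W m)) (W m)

  pairSum-mono : ∀ m {f g} → (∀ x y → f x y ≤ g x y) → pairSumW m f ≤ pairSumW m g
  pairSum-mono m f≤g = sum-mono (λ x → sum-mono (f≤g x) (W m)) (W m)

  pairSum-+ : ∀ m f g → pairSumW m (λ x y → f x y + g x y) ≡ pairSumW m f + pairSumW m g
  pairSum-+ m f g = trans (sum-cong (λ x → sum-+ (f x) (g x) (W m)) (W m))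
                          (sum-+ (λ x → sumOver (f x) (W m)) (λ x → sumOver (g x) (W m)) (W m))

  pairSum-separable : ∀ m (g : Vec (Fin N) m → ℕ) c →
    pairSumW m (λ x y → g x + g y + c) ≡ N ^ m * sumOver g (W m) + N ^ m * sumOver g (W m) + N ^ m * (N ^ m * c)
  pairSum-separable m g c = begin
      pairSumW m (λ x y → g x + g y + c)
    ≡⟨ sum-cong inner (W m) ⟩
      ∑[ x ∈ W m ] (N ^ m * g x + Σg + N ^ m * c)
    ≡⟨ sum-+ (λ x → N ^ m * g x + Σg) (λ _ → N ^ m * c) (W m) ⟩
      ∑[ x ∈ W m ] (N ^ m * g x + Σg) + ∑[ x ∈ W m ] (N ^ m * c)
    ≡⟨ cong₂ _+_ (trans (sum-+ (λ x → N ^ m * g x) (λ _ → Σg) (W m))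
                        (cong₂ _+_ (sum-*ˡ (N ^ m) g (W m)) (sum-const-words m Σg)))
                 (sum-const-words m (N ^ m * c)) ⟩
      N ^ m * Σg + N ^ m * Σg + N ^ m * (N ^ m * c)
    ∎
    where
    open ≡-Reasoning
    Σg = sumOver g (W m)
    inner : ∀ x → ∑[ y ∈ W m ] (g x + g y + c) ≡ N ^ m * g x + Σg + N ^ m * c
    inner x = trans (sum-+ (λ y → g x + g y) (λ _ → c) (W m))
                (cong₂ _+_ (trans (sum-+ (λ _ → g x) g (W m)) (cong (_+ Σg) (sum-const-words m (g x))))
                           (sum-const-words m c))

  sameHead : ∀ {m} → Vec (Fin N) (suc m) → Vec (Fin N) (suc m) → ℕ → ℕ
  sameHead (a ∷ _) (b ∷ _) = onDiagonal a b

  pairSum-sameHead : ∀ m (f : Vec (Fin N) (suc m) → Vec (Fin N) (suc m) → ℕ) →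
    pairSumW (suc m) (λ X Y → sameHead X Y (f X Y)) ≡ ∑[ a ∈ allFin N ] pairSumW m (λ x y → f (a ∷ x) (a ∷ y))
  pairSum-sameHead m f = begin
      pairSumW (suc m) (λ X Y → sameHead X Y (f X Y))
    ≡⟨ sum-words-suc m _ ⟩
      ∑[ a ∈ allFin N ] ∑[ x ∈ W m ] ∑[ Y ∈ W (suc m) ] sameHead (a ∷ x) Y (f (a ∷ x) Y)
    ≡⟨ sum-cong (λ a → sum-cong (λ x → sum-words-suc m _) (W m)) (allFin N) ⟩
      ∑[ a ∈ allFin N ] ∑[ x ∈ W m ] ∑[ b ∈ allFin N ] ∑[ y ∈ W m ] onDiagonal a b (f (a ∷ x) (b ∷ y))
    ≡⟨ sum-cong (λ a → sum-cong (λ x → diagonal a x) (W m)) (allFin N) ⟩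
      ∑[ a ∈ allFin N ] pairSumW m (λ x y → f (a ∷ x) (a ∷ y))
    ∎
    where
    open ≡-Reasoning
    diagonal : ∀ a x → ∑[ b ∈ allFin N ] ∑[ y ∈ W m ] onDiagonal a b (f (a ∷ x) (b ∷ y))
                       ≡ ∑[ y ∈ W m ] f (a ∷ x) (a ∷ y)
    diagonal a x = trans (sum-cong (λ b → onDiagonal-sum a b (λ y → f (a ∷ x) (b ∷ y)) (W m)) (allFin N))
                         (sum-onDiagonal a (λ b → ∑[ y ∈ W m ] f (a ∷ x) (b ∷ y)))

4ab≤[a+b]² : ∀ a b → 4 * a * b ≤ (a + b) * (a + b)
4ab≤[a+b]² a b with ≤-total a b
... | inj₁ a≤b with m≤n⇒∃[o]m+o≡n a≤b
...   | r , refl = ≤-trans (m≤m+n _ (r * r)) (≤-reflexive (sym (square a r)))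
  where
  square : ∀ a r → (a + (a + r)) * (a + (a + r)) ≡ 4 * a * (a + r) + r * r
  square = solve-∀
4ab≤[a+b]² a b | inj₂ b≤a with m≤n⇒∃[o]m+o≡n b≤a
...   | r , refl = ≤-trans (m≤m+n _ (r * r)) (≤-reflexive (sym (square b r)))
  where
  square : ∀ b r → (b + r + b) * (b + r + b) ≡ 4 * (b + r) * b + r * r
  square = solve-∀

module AltSums {N : ℕ} (G : BipGraph N) where
  open BipGraph G
  open Words G
  open WordSums N

  sum-by-side : ∀ (g : Side → ℕ) xs → ∑[ a ∈ xs ] g (col a) ≡ g one * count G one xs + g two * count G two xs
  sum-by-side g List.[] = sym (cong₂ _+_ (*-zeroʳ (g one)) (*-zeroʳ (g two)))
  sum-by-side g (x List.∷ xs) with col x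
  ... | one = trans (cong (g one +_) (sum-by-side g xs)) (add-one (g one) (g two) _ _)
    where
    add-one : ∀ p q c₁ c₂ → p + (p * c₁ + q * c₂) ≡ p * suc c₁ + q * c₂
    add-one = solve-∀
  ... | two = trans (cong (g two +_) (sum-by-side g xs)) (add-two (g one) (g two) _ _)
    where
    add-two : ∀ p q c₁ c₂ → q + (p * c₁ + q * c₂) ≡ p * c₁ + q * suc c₂
    add-two = solve-∀

  N≡n₁+n₂ : N ≡ n₁ G + n₂ G
  N≡n₁+n₂ = begin
    N                               ≡⟨ trans (sum-const-letters 1) (*-identityʳ N) ⟨
    ∑[ a ∈ allFin N ] 1             ≡⟨ sum-by-side (λ _ → 1) (allFin N) ⟩
    1 * n₁ G + 1 * n₂ G             ≡⟨ cong₂ _+_ (*-identityˡ (n₁ G)) (*-identityˡ (n₂ G)) ⟩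
    n₁ G + n₂ G                     ∎
    where open ≡-Reasoning

  K : ℕ
  K = ∑[ a ∈ allFin N ] ∑[ b ∈ allFin N ] change (col a) (col b)

  2K≡4n₁n₂ : 2 * K ≡ 4 * n₁ G * n₂ G
  2K≡4n₁n₂ = begin
      2 * K
    ≡⟨ cong (2 *_) (sum-cong (λ a → sum-by-side (change (col a)) (allFin N)) (allFin N)) ⟩
      2 * ∑[ a ∈ allFin N ] (change (col a) one * n₁ G + change (col a) two * n₂ G)
    ≡⟨ cong (2 *_) (sum-by-side (λ s → change s one * n₁ G + change s two * n₂ G) (allFin N)) ⟩
      2 * ((0 * n₁ G + 1 * n₂ G) * n₁ G + (1 * n₁ G + 0 * n₂ G) * n₂ G)
    ≡⟨ collect (n₁ G) (n₂ G) ⟩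
      4 * n₁ G * n₂ G
    ∎
    where
    open ≡-Reasoning
    collect : ∀ p q → 2 * ((0 * p + 1 * q) * p + (1 * p + 0 * q) * q) ≡ 4 * p * q
    collect = solve-∀

  2K≤N² : 2 * K ≤ N * N
  2K≤N² = subst₂ _≤_ (sym 2K≡4n₁n₂) (cong₂ _*_ (sym N≡n₁+n₂) (sym N≡n₁+n₂)) (4ab≤[a+b]² (n₁ G) (n₂ G))

  T : ℕ → ℕ
  T m = sumOver alt (W m)

  T-one : T 1 ≡ 0
  T-one = trans (sum-words-suc 0 alt) (trans (sum-const 0 (allFin N)) (*-zeroʳ (List.length (allFin N))))

  -- Splitting off the first letter: the first side change contributes Nᵐ K.
  T-rec : ∀ m → T (suc (suc m)) ≡ N ^ m * K + N * T (suc m)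
  T-rec m = begin
      T (suc (suc m))
    ≡⟨ sum-words-suc (suc m) alt ⟩
      ∑[ a ∈ allFin N ] ∑[ w ∈ W (suc m) ] alt (a ∷ w)
    ≡⟨ sum-cong (λ a → sum-words-suc m (λ w → alt (a ∷ w))) (allFin N) ⟩
      ∑[ a ∈ allFin N ] ∑[ b ∈ allFin N ] ∑[ w ∈ W m ] (change (col a) (col b) + alt (b ∷ w))
    ≡⟨ sum-cong (λ a → sum-cong (split a) (allFin N)) (allFin N) ⟩
      ∑[ a ∈ allFin N ] ∑[ b ∈ allFin N ] (N ^ m * change (col a) (col b) + ∑[ w ∈ W m ] alt (b ∷ w))
    ≡⟨ sum-cong split′ (allFin N) ⟩
      ∑[ a ∈ allFin N ] (N ^ m * ∑[ b ∈ allFin N ] change (col a) (col b) + T (suc m))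
    ≡⟨ sum-+ (λ a → N ^ m * ∑[ b ∈ allFin N ] change (col a) (col b)) (λ _ → T (suc m)) (allFin N) ⟩
      ∑[ a ∈ allFin N ] (N ^ m * ∑[ b ∈ allFin N ] change (col a) (col b)) + ∑[ a ∈ allFin N ] T (suc m)
    ≡⟨ cong₂ _+_ (sum-*ˡ (N ^ m) (λ a → ∑[ b ∈ allFin N ] change (col a) (col b)) (allFin N))
                 (sum-const-letters (T (suc m))) ⟩
      N ^ m * K + N * T (suc m)
    ∎
    where
    open ≡-Reasoning
    split : ∀ a b → ∑[ w ∈ W m ] (change (col a) (col b) + alt (b ∷ w))
                    ≡ N ^ m * change (col a) (col b) + ∑[ w ∈ W m ] alt (b ∷ w)
    split a b = trans (sum-+ (λ _ → change (col a) (col b)) (λ w → alt (b ∷ w)) (W m))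
                      (cong (_+ _) (sum-const-words m (change (col a) (col b))))
    split′ : ∀ a → ∑[ b ∈ allFin N ] (N ^ m * change (col a) (col b) + ∑[ w ∈ W m ] alt (b ∷ w))
                   ≡ N ^ m * ∑[ b ∈ allFin N ] change (col a) (col b) + T (suc m)
    split′ a = trans (sum-+ (λ b → N ^ m * change (col a) (col b)) (λ b → ∑[ w ∈ W m ] alt (b ∷ w)) (allFin N))
                     (cong₂ _+_ (sum-*ˡ (N ^ m) (λ b → change (col a) (col b)) (allFin N))
                                (sym (sum-words-suc m alt)))

  -- Closed form: N² T (m + 1) = K m Nᵐ⁺¹, i.e. E[alt] = (K / N²) m.
  T-closed : ∀ m → N * N * T (suc m) ≡ K * m * N ^ suc m
  T-closed zero    = trans (cong (N * N *_) T-one) (trans (*-zeroʳ (N * N)) (cong (_* N ^ 1) (sym (*-zeroʳ K))))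
  T-closed (suc m) = begin
      N * N * T (suc (suc m))
    ≡⟨ cong (N * N *_) (T-rec m) ⟩
      N * N * (N ^ m * K + N * T (suc m))
    ≡⟨ expand N (N ^ m) K (T (suc m)) ⟩
      N * N * N ^ m * K + N * (N * N * T (suc m))
    ≡⟨ cong (λ t → N * N * N ^ m * K + N * t) (T-closed m) ⟩
      N * N * N ^ m * K + N * (K * m * (N * N ^ m))
    ≡⟨ collect N (N ^ m) K m ⟩
      K * suc m * N ^ suc (suc m)
    ∎
    where
    open ≡-Reasoning
    expand : ∀ N P K T → N * N * (P * K + N * T) ≡ N * N * P * K + N * (N * N * T)
    expand = solve-∀
    collect : ∀ N P K m → N * N * P * K + N * (K * m * (N * P)) ≡ K * suc m * (N * (N * P))
    collect = solve-∀

  S : ℕ → ℕ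
  S m = pairSumW m ℓ

  ℓ-split : ∀ {m} (X Y : Word (suc m)) →
            ℓ X Y + sameHead X Y (alt X + alt Y + 1) ≡ sameHead X Y (ℓ (tail X) (tail Y)) + (alt X + alt Y + 1)
  ℓ-split (a ∷ x) (b ∷ y) with a ≟ b
  ... | yes _ = refl
  ... | no  _ = trans (+-identityʳ _) (+-comm 1 (alt (a ∷ x) + alt (b ∷ y)))

  S-rec : ∀ m → S (suc m) + (N ^ m * T (suc m) + N ^ m * T (suc m) + N * (N ^ m * (N ^ m * 1)))
                ≡ N * S m + (N ^ suc m * T (suc m) + N ^ suc m * T (suc m) + N ^ suc m * (N ^ suc m * 1))
  S-rec m = begin
      S (suc m) + (P * T′ + P * T′ + N * (P * (P * 1)))
    ≡⟨ cong (S (suc m) +_) diagonal ⟨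
      S (suc m) + pairSumW (suc m) (λ X Y → sameHead X Y (alt X + alt Y + 1))
    ≡⟨ pairSum-+ (suc m) ℓ (λ X Y → sameHead X Y (alt X + alt Y + 1)) ⟨
      pairSumW (suc m) (λ X Y → ℓ X Y + sameHead X Y (alt X + alt Y + 1))
    ≡⟨ pairSum-cong (suc m) ℓ-split ⟩
      pairSumW (suc m) (λ X Y → sameHead X Y (ℓ (tail X) (tail Y)) + (alt X + alt Y + 1))
    ≡⟨ pairSum-+ (suc m) (λ X Y → sameHead X Y (ℓ (tail X) (tail Y))) (λ X Y → alt X + alt Y + 1) ⟩
      pairSumW (suc m) (λ X Y → sameHead X Y (ℓ (tail X) (tail Y))) + pairSumW (suc m) (λ X Y → alt X + alt Y + 1)
    ≡⟨ cong₂ _+_ (trans (pairSum-sameHead m (λ X Y → ℓ (tail X) (tail Y))) (sum-const-letters (S m)))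
                 (pairSum-separable (suc m) alt 1) ⟩
      N * S m + (N ^ suc m * T′ + N ^ suc m * T′ + N ^ suc m * (N ^ suc m * 1))
    ∎
    where
    open ≡-Reasoning
    P  = N ^ m
    T′ = T (suc m)
    A : Fin N → ℕ
    A a = ∑[ w ∈ W m ] alt (a ∷ w)
    diagonal : pairSumW (suc m) (λ X Y → sameHead X Y (alt X + alt Y + 1)) ≡ P * T′ + P * T′ + N * (P * (P * 1))
    diagonal = begin
        pairSumW (suc m) (λ X Y → sameHead X Y (alt X + alt Y + 1))
      ≡⟨ pairSum-sameHead m (λ X Y → alt X + alt Y + 1) ⟩
        ∑[ a ∈ allFin N ] pairSumW m (λ x y → alt (a ∷ x) + alt (a ∷ y) + 1)
      ≡⟨ sum-cong (λ a → pairSum-separable m (λ w → alt (a ∷ w)) 1) (allFin N) ⟩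
        ∑[ a ∈ allFin N ] (P * A a + P * A a + P * (P * 1))
      ≡⟨ sum-+ (λ a → P * A a + P * A a) (λ _ → P * (P * 1)) (allFin N) ⟩
        ∑[ a ∈ allFin N ] (P * A a + P * A a) + ∑[ a ∈ allFin N ] (P * (P * 1))
      ≡⟨ cong₂ _+_ (trans (sum-+ (λ a → P * A a) (λ a → P * A a) (allFin N))
                          (cong₂ _+_ PT′ PT′))
                   (sum-const-letters (P * (P * 1))) ⟩
        P * T′ + P * T′ + N * (P * (P * 1))
      ∎
      where
      PT′ : ∑[ a ∈ allFin N ] (P * A a) ≡ P * T′
      PT′ = trans (sum-*ˡ P A (allFin N)) (cong (P *_) (sym (sum-words-suc m alt)))

-- Arithmetic for the lower estimate Σ ℓ > 2 Nⁿ Σ alt (base case n = 1):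
-- the recurrence for Σ ℓ with T = 0 says S + N = N², so S ≥ 1.
S-lower-base : ∀ M S T → let N = suc (suc M) in T ≡ 0 →
  S + (1 * T + 1 * T + N * (1 * (1 * 1))) ≡ N * 0 + (N * 1 * T + N * 1 * T + N * 1 * (N * 1 * 1)) →
  suc (2 * (N * 1) * T) ≤ S
S-lower-base M S .0 refl rec = subst (_≤ S) (cong suc (sym (*-zeroʳ (2 * (N * 1))))) (positive S S+N≡N²)
  where
  N = suc (suc M)
  S+N≡N² : S + N ≡ N * N
  S+N≡N² = trans (cong (S +_) (sym (lhs M))) (trans rec (rhs M))
    where
    lhs : ∀ M → let N = suc (suc M) in 1 * 0 + 1 * 0 + N * (1 * (1 * 1)) ≡ N
    lhs = solve-∀
    rhs : ∀ M → let N = suc (suc M) in N * 0 + (N * 1 * 0 + N * 1 * 0 + N * 1 * (N * 1 * 1)) ≡ N * N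
    rhs = solve-∀
  positive : ∀ S → S + N ≡ N * N → 1 ≤ S
  positive zero    eq = ⊥-elim (<-irrefl eq (m<m*n N N (s≤s (s≤s z≤n))))
  positive (suc S) eq = s≤s z≤n

-- Arithmetic for the inductive step, with P = Nᵐ, Q = N P, T′ = P K + N T:
-- the recurrence for Σ ℓ and 2K ≤ N² carry  S > 2 Q T  over to  S′ > 2 N Q T′.
S-lower-step : ∀ M P K T T′ S S′ → let N = suc (suc M) ; Q = N * P in
  T′ ≡ P * K + N * T → 2 * K ≤ N * N → suc (2 * Q * T) ≤ S →
  S′ + (Q * T′ + Q * T′ + N * (Q * (Q * 1))) ≡ N * S + (N * Q * T′ + N * Q * T′ + N * Q * (N * Q * 1)) →
  suc (2 * (N * Q) * T′) ≤ S′
S-lower-step M P K T .(P * K + suc (suc M) * T) S S′ refl 2K≤N² ih rec =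
  +-cancelʳ-≤ E _ _ (≤-trans chain (≤-reflexive (sym rec)))
  where
  N  = suc (suc M)
  Q  = N * P
  T′ = P * K + N * T
  E  = Q * T′ + Q * T′ + N * (Q * (Q * 1))
  F  = N * Q * T′ + N * Q * T′ + N * Q * (N * Q * 1)
  C  = suc (2 * (N * Q) * T′ + 2 * (N * Q) * T + N * (Q * Q))
  lhs : ∀ M P K T → let N = suc (suc M) ; Q = N * P ; T′ = P * K + N * T in
        suc (2 * (N * Q) * T′) + (Q * T′ + Q * T′ + N * (Q * (Q * 1)))
        ≡ suc (2 * (N * Q) * T′ + 2 * (N * Q) * T + N * (Q * Q)) + 2 * K * (Q * P)
  lhs = solve-∀
  rhs : ∀ M P K T → let N = suc (suc M) ; Q = N * P ; T′ = P * K + N * T in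
        N * suc (2 * Q * T) + (N * Q * T′ + N * Q * T′ + N * Q * (N * Q * 1))
        ≡ suc (2 * (N * Q) * T′ + 2 * (N * Q) * T + N * (Q * Q)) + N * N * (Q * P) + (suc M + M * (N * Q * Q))
  rhs = solve-∀
  chain : suc (2 * (N * Q) * T′) + E ≤ N * S + F
  chain = begin
    suc (2 * (N * Q) * T′) + E                    ≡⟨ lhs M P K T ⟩
    C + 2 * K * (Q * P)                           ≤⟨ +-monoʳ-≤ C (*-monoˡ-≤ (Q * P) 2K≤N²) ⟩
    C + N * N * (Q * P)                           ≤⟨ m≤m+n _ _ ⟩
    C + N * N * (Q * P) + (suc M + M * (N * Q * Q)) ≡⟨ rhs M P K T ⟨
    N * suc (2 * Q * T) + F                       ≤⟨ +-monoˡ-≤ F (*-monoʳ-≤ N ih) ⟩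
    N * S + F                                     ∎
    where open ≤-Reasoning

lower-arith : ∀ N Q T K m S → 0 < N → N * N * T ≡ K * m * Q → suc (2 * Q * T) ≤ S →
              2 * K * m * (Q * Q) < S * N ^ 2
lower-arith N Q T K m S 0<N closed S> = begin-strict
    2 * K * m * (Q * Q)        ≡⟨ regroup K m Q ⟩
    2 * Q * (K * m * Q)        ≡⟨ cong (2 * Q *_) closed ⟨
    2 * Q * (N * N * T)        ≡⟨ regroup′ N Q T ⟩
    2 * Q * T * N ^ 2          <⟨ m<m+n (2 * Q * T * N ^ 2) (*-mono-< 0<N (*-mono-< 0<N (s≤s z≤n))) ⟩
    2 * Q * T * N ^ 2 + N ^ 2  ≡⟨ +-comm (2 * Q * T * N ^ 2) (N ^ 2) ⟩
    suc (2 * Q * T) * N ^ 2    ≤⟨ *-monoˡ-≤ (N ^ 2) S> ⟩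
    S * N ^ 2                  ∎
  where
  open ≤-Reasoning
  regroup : ∀ K m Q → 2 * K * m * (Q * Q) ≡ 2 * Q * (K * m * Q)
  regroup = solve-∀
  regroup′ : ∀ N Q T → 2 * Q * (N * N * T) ≡ 2 * Q * T * (N * (N * 1))
  regroup′ = solve-∀

upper-arith : ∀ L Q T K m U → let N = suc L in 0 < Q → N * N * T ≡ K * m * Q →
              U ≤ Q * T + Q * T + Q * (Q * L) → U * N ^ 2 < (N * N ^ 2 + 2 * K * m) * (Q * Q)
upper-arith L Q T K m U 0<Q closed U≤ = begin-strict
    U * N ^ 2                                      ≤⟨ *-monoˡ-≤ (N ^ 2) U≤ ⟩
    (Q * T + Q * T + Q * (Q * L)) * N ^ 2           ≡⟨ expand L Q T ⟩
    2 * Q * (N * N * T) + Q * Q * L * N ^ 2         ≡⟨ cong (λ t → 2 * Q * t + Q * Q * L * N ^ 2) closed ⟩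
    2 * Q * (K * m * Q) + Q * Q * L * N ^ 2         <⟨ m<m+n _ (*-mono-< (*-mono-< 0<Q 0<Q) (s≤s z≤n)) ⟩
    2 * Q * (K * m * Q) + Q * Q * L * N ^ 2 + Q * Q * N ^ 2 ≡⟨ collect L Q K m ⟩
    (N * N ^ 2 + 2 * K * m) * (Q * Q)              ∎
  where
  open ≤-Reasoning
  N = suc L
  expand : ∀ L Q T → let N = suc L in
           (Q * T + Q * T + Q * (Q * L)) * (N * (N * 1)) ≡ 2 * Q * (N * N * T) + Q * Q * L * (N * (N * 1))
  expand = solve-∀
  collect : ∀ L Q K m → let N = suc L in
            2 * Q * (K * m * Q) + Q * Q * L * (N * (N * 1)) + Q * Q * (N * (N * 1))
            ≡ (N * (N * (N * 1)) + 2 * K * m) * (Q * Q)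
  collect = solve-∀

module ExpectedDistance (M : ℕ) (G : BipGraph (suc (suc M))) (conn : Connected G) where
  open Words G
  open Distance M G conn
  open WordSums (suc (suc M))
  open AltSums G

  N : ℕ
  N = suc (suc M)

  S-lower : ∀ m → suc (2 * N ^ suc m * T (suc m)) ≤ S (suc m)
  S-lower zero    = S-lower-base M (S 1) (T 1) T-one (S-rec 0)
  S-lower (suc m) = S-lower-step M (N ^ m) K (T (suc m)) (T (suc (suc m))) (S (suc m)) (S (suc (suc m)))
                      (T-rec m) 2K≤N² (S-lower m) (S-rec (suc m))

  N^2n : ∀ n → N ^ (2 * n) ≡ N ^ n * N ^ n
  N^2n n = trans (^-distribˡ-+-* N n (n + 0)) (cong (λ k → N ^ n * N ^ k) (+-identityʳ n))

  -- Σ d ≥ Σ ℓ > 2 Nⁿ Σ alt = 4 n₁ n₂ (n − 1) N²ⁿ / N²  (n = m + 1).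
  lower-bound : ∀ m → 4 * n₁ G * n₂ G * m * N ^ (2 * suc m) < pairSum G (suc m) dist * N ^ 2
  lower-bound m = subst₂ (λ c q → c * q < pairSum G (suc m) dist * N ^ 2)
                    (cong (_* m) 2K≡4n₁n₂) (sym (N^2n (suc m)))
                    (lower-arith N (N ^ suc m) (T (suc m)) K m _ (s≤s z≤n) (T-closed m)
                       (≤-trans (S-lower m) (pairSum-mono (suc m) dist-lower)))

  -- Σ d ≤ Σ (alt x + alt y + N − 1) = 4 n₁ n₂ (n − 1) N²ⁿ / N² + (N − 1) N²ⁿ.
  upper-bound : ∀ m → pairSum G (suc m) dist * N ^ 2 < (N * N ^ 2 + 4 * n₁ G * n₂ G * m) * N ^ (2 * suc m)
  upper-bound m = subst₂ (λ c q → pairSum G (suc m) dist * N ^ 2 < (N * N ^ 2 + c) * q)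
                    (cong (_* m) 2K≡4n₁n₂) (sym (N^2n (suc m)))
                    (upper-arith (suc M) Q (T (suc m)) K m _ (m^n>0 N (suc m)) (T-closed m)
                       (≤-trans (pairSum-mono (suc m) dist-upper) (≤-reflexive (pairSum-separable (suc m) alt (suc M)))))
    where Q = N ^ suc m

-- N = 0 and N = 1 are impossible, V₁ and V₂ being nonempty and disjoint;
-- for N ≥ 2 the distance dist of Gₙ satisfies both bounds (ExpectedDistance).
mainTheorem9 : (N : ℕ) (G : BipGraph N) → Connected G → (n : ℕ) → 1 ≤ n →
    Σ (Vec (Fin N) n → Vec (Fin N) n → ℕ) (λ d →
    (∀ x y → IsShortestDist (AdjGn G) x y (d x y))
    × (4 * n₁ G * n₂ G * (n ∸ 1) * N ^ (2 * n) < pairSum G n d * N ^ 2)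
    × (pairSum G n d * N ^ 2 < (N * N ^ 2 + 4 * n₁ G * n₂ G * (n ∸ 1)) * N ^ (2 * n)))
mainTheorem9 zero G _ _ _ with BipGraph.V₁-nonempty G
... | () , _
mainTheorem9 (suc zero) G _ _ _ with BipGraph.V₁-nonempty G | BipGraph.V₂-nonempty G
... | zero , inV₁ | zero , inV₂ with trans (sym inV₁) inV₂
...   | ()
mainTheorem9 (suc (suc M)) G conn (suc m) _ = dist , dist-isShortest , lower-bound m , upper-bound m
  where open Distance M G conn
        open ExpectedDistance M G conn
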